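{- Let $p=(i_0,j_0,k_0)\in\mathbb{Z}^3_{\rm odd}$ and $\mathbf{k}$ a stepped surface with $k_0\ge\mathbf{k}(i_0,j_0)$ and $\mathbf{k}\ge\mathbf{fund}$. Then the graph $G=G_{p,\mathbf{k}}$ and its closure $\overline{G}$ are bipartite and connected.
   Context: $\mathbb{Z}^3_{\rm odd}=\{(i,j,k): i+j+k\text{ odd}\}$. A stepped surface is $\mathbf{k}:\mathbb{Z}^2\to\mathbb{Z}$ with $i+j+\mathbf{k}(i,j)$ odd and $|\mathbf{k}(i,j)-\mathbf{k}(i',j')|=1$ whenever $|i-i'|+|j-j'|=1$. $\mathbf{fund}(i,j)=(i+j\bmod2)-1$; $\mathbf{proj}_p(i,j)=k_0-|i-i_0|-|j-j_0|$; $\mathbf{k}_p=\min(\mathbf{k},\mathbf{proj}_p)$. For a stepped surface $\mathbf{h}$, the quiver $\mathcal{Q}_{\mathbf{h}}$ has vertex set $\mathbb{Z}^2$ drawn at lattice points: arrow between $(i,j),(i+1,j)$ from higher to lower $\mathbf{h}$-value; between $(i,j),(i,j+1)$ from lower to higher; in a unit square $A=(i,j),B=(i+1,j),C=(i+1,j+1),D=(i,j+1)$: no diagonal if $\mathbf{h}(A)=\mathbf{h}(C)$ and $\mathbf{h}(B)=\mathbf{h}(D)$; if $\mathbf{h}(A)=\mathbf{h}(C)=h$, diagonal $A\to C$ when $\mathbf{h}(B)=h+1$ and $C\to A$ when $\mathbf{h}(B)=h-1$; if $\mathbf{h}(B)=\mathbf{h}(D)=h$, diagonal $D\to B$ when $\mathbf{h}(A)=h-1$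 and $B\to D$ when $\mathbf{h}(A)=h+1$. $G_{\mathbf{h}}$ is the planar dual of $\mathcal{Q}_{\mathbf{h}}$: one vertex per bounded face of $\mathcal{Q}_{\mathbf{h}}$ (white if its oriented boundary cycle is counterclockwise, black if clockwise), one edge per arrow joining the two faces on either side. $\mathring{F}=\{(i,j):|i-i_0|+|j-j_0|<k_0-\mathbf{k}(i,j)\}$, $\partial F=\{(i',j')\notin\mathring{F}$ lattice-adjacent to some point of $\mathring{F}\}$ (and $\partial F=\{(i_0,j_0)\}$ if $k_0=\mathbf{k}(i_0,j_0)$). $G=G_{p,\mathbf{k}}$ is the finite subgraph of $G_{\mathbf{k}}$ generated by the faces in $\mathring{F}$ (vertices: faces of $\mathcal{Q}_{\mathbf{k}}$ with a corner in $\mathring{F}$; edges: those dual to arrows with an endpoint in $\mathring{F}$). The closure $\overline{G}$ is the analogous subgraph of $G_{\mathbf{k}_p}$ generated by the faces in $\mathring{F}\cup\partial F$. -}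

module Defs where

open import Data.Integer using (ℤ; +_; _+_; _-_; _*_; _<_; _≤_; _>_; ∣_∣; _⊓_; _%ℕ_)
open import Data.Nat using (ℕ)
import Data.Nat as ℕ
open import Data.Product using (_×_; _,_; Σ; ∃; ∃-syntax)
open import Data.Sum using (_⊎_)
open import Data.List using (List; []; _∷_)
open import Data.List.Membership.Propositional using (_∈_)
open import Data.List.Relation.Unary.All using (All)
open import Data.List.Relation.Unary.Any using (Any)
open import Relation.Nullary using (¬_)
open import Relation.Binary.PropositionalEquality using (_≡_; _≢_)
open import Relation.Binary.Construct.Closure.ReflexiveTransitive using (Star)
open import Relation.Binary.Construct.Closure.Symmetric using (SymClosure)

Pt : Set
Pt = ℤ × ℤ

1ℤ : ℤ
1ℤ = + 1

IsOdd : ℤ → Set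
IsOdd z = Σ ℤ λ m → z ≡ 1ℤ + (+ 2) * m

SteppedSurface : (Pt → ℤ) → Set
SteppedSurface k =
  (∀ i j → IsOdd (i + j + k (i , j))) ×
  (∀ i j → ∣ k (i + 1ℤ , j) - k (i , j) ∣ ≡ 1) ×
  (∀ i j → ∣ k (i , j + 1ℤ) - k (i , j) ∣ ≡ 1)

fund : Pt → ℤ
fund (i , j) = + ((i + j) %ℕ 2) - 1ℤ

dist : Pt → Pt → ℕ
dist (i , j) (i' , j') = ∣ i - i' ∣ ℕ.+ ∣ j - j' ∣

-- proj_p(i,j) = k0 - |i-i0| - |j-j0|, with p = (i0,j0,k0) given as (q0 , k0)
proj : Pt → ℤ → Pt → ℤ
proj q0 k0 q = k0 - + dist q q0

kp : (Pt → ℤ) → Pt → ℤ → Pt → ℤ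
kp k q0 k0 q = k q ⊓ proj q0 k0 q

-- The quiver Q_h.  Arrow h u v : there is an arrow u → v.
-- Square with A=(i,j), B=(i+1,j), C=(i+1,j+1), D=(i,j+1).

data Arrow (h : Pt → ℤ) : Pt → Pt → Set where
  horR : ∀ {i j} → h (i , j) > h (i + 1ℤ , j) → Arrow h (i , j) (i + 1ℤ , j)
  horL : ∀ {i j} → h (i + 1ℤ , j) > h (i , j) → Arrow h (i + 1ℤ , j) (i , j)
  verU : ∀ {i j} → h (i , j) < h (i , j + 1ℤ) → Arrow h (i , j) (i , j + 1ℤ)
  verD : ∀ {i j} → h (i , j + 1ℤ) < h (i , j) → Arrow h (i , j + 1ℤ) (i , j)
  diagAC : ∀ {i j} → h (i , j) ≡ h (i + 1ℤ , j + 1ℤ) → h (i + 1ℤ , j) ≢ h (i , j + 1ℤ) →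
           h (i + 1ℤ , j) ≡ h (i , j) + 1ℤ → Arrow h (i , j) (i + 1ℤ , j + 1ℤ)
  diagCA : ∀ {i j} → h (i , j) ≡ h (i + 1ℤ , j + 1ℤ) → h (i + 1ℤ , j) ≢ h (i , j + 1ℤ) →
           h (i + 1ℤ , j) ≡ h (i , j) - 1ℤ → Arrow h (i + 1ℤ , j + 1ℤ) (i , j)
  diagDB : ∀ {i j} → h (i + 1ℤ , j) ≡ h (i , j + 1ℤ) → h (i , j) ≢ h (i + 1ℤ , j + 1ℤ) →
           h (i , j) ≡ h (i + 1ℤ , j) - 1ℤ → Arrow h (i , j + 1ℤ) (i + 1ℤ , j)
  diagBD : ∀ {i j} → h (i + 1ℤ , j) ≡ h (i , j + 1ℤ) → h (i , j) ≢ h (i + 1ℤ , j + 1ℤ) →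
           h (i , j) ≡ h (i + 1ℤ , j) + 1ℤ → Arrow h (i + 1ℤ , j) (i , j + 1ℤ)

-- Bounded faces of Q_h, each represented by its list of corners in
-- counterclockwise order (starting corner fixed, so the representation is canonical).
data Face (h : Pt → ℤ) : List Pt → Set where
  square : ∀ {i j} → h (i , j) ≡ h (i + 1ℤ , j + 1ℤ) → h (i + 1ℤ , j) ≡ h (i , j + 1ℤ) →
    Face h ((i , j) ∷ (i + 1ℤ , j) ∷ (i + 1ℤ , j + 1ℤ) ∷ (i , j + 1ℤ) ∷ [])
  triABC : ∀ {i j} → h (i , j) ≡ h (i + 1ℤ , j + 1ℤ) → h (i + 1ℤ , j) ≢ h (i , j + 1ℤ) →
    Face h ((i , j) ∷ (i + 1ℤ , j) ∷ (i + 1ℤ , j + 1ℤ) ∷ [])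
  triACD : ∀ {i j} → h (i , j) ≡ h (i + 1ℤ , j + 1ℤ) → h (i + 1ℤ , j) ≢ h (i , j + 1ℤ) →
    Face h ((i , j) ∷ (i + 1ℤ , j + 1ℤ) ∷ (i , j + 1ℤ) ∷ [])
  triABD : ∀ {i j} → h (i + 1ℤ , j) ≡ h (i , j + 1ℤ) → h (i , j) ≢ h (i + 1ℤ , j + 1ℤ) →
    Face h ((i , j) ∷ (i + 1ℤ , j) ∷ (i , j + 1ℤ) ∷ [])
  triBCD : ∀ {i j} → h (i + 1ℤ , j) ≡ h (i , j + 1ℤ) → h (i , j) ≢ h (i + 1ℤ , j + 1ℤ) →
    Face h ((i + 1ℤ , j) ∷ (i + 1ℤ , j + 1ℤ) ∷ (i , j + 1ℤ) ∷ [])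

cycPairs : List Pt → List (Pt × Pt)
cycPairs [] = []
cycPairs (x ∷ xs) = go (x ∷ xs)
  where
  go : List Pt → List (Pt × Pt)
  go [] = []
  go (y ∷ []) = (y , x) ∷ []
  go (y ∷ z ∷ zs) = (y , z) ∷ go (z ∷ zs)

-- white: oriented boundary cycle is counterclockwise; black: clockwise
White : (Pt → ℤ) → List Pt → Set
White h f = Face h f × All (λ e → Arrow h (Data.Product.proj₁ e) (Data.Product.proj₂ e)) (cycPairs f)

Black : (Pt → ℤ) → List Pt → Set
Black h f = Face h f × All (λ e → Arrow h (Data.Product.proj₂ e) (Data.Product.proj₁ e)) (cycPairs f)

-- Subgraph of G_h generated by the faces in a set S of lattice points:
-- vertices = faces with a corner in S,
-- edges = duals of arrows u → v with an endpoint in S, joining the face on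
-- the left of the arrow (traversing (u,v) counterclockwise) and the face on
-- its right (traversing (v,u) counterclockwise).

GenVert : (Pt → ℤ) → (Pt → Set) → List Pt → Set
GenVert h S f = Face h f × Any S f

GenEdge : (Pt → ℤ) → (Pt → Set) → List Pt → List Pt → Set
GenEdge h S f g = Σ Pt λ u → Σ Pt λ v →
  Arrow h u v × (S u ⊎ S v) × Face h f × Face h g ×
  (u , v) ∈ cycPairs f × (v , u) ∈ cycPairs g

Bipartite : (Pt → ℤ) → (List Pt → Set) → (List Pt → List Pt → Set) → Set
Bipartite h V E =
  (∀ f → V f → White h f ⊎ Black h f) ×
  (∀ f g → E f g → (White h f × Black h g) ⊎ (Black h f × White h g))

Connected : (List Pt → Set) → (List Pt → List Pt → Set) → Set
Connected V E = ∀ f g → V f → V g → Star (SymClosure E) f g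

Fint : (Pt → ℤ) → Pt → ℤ → Pt → Set
Fint k q0 k0 q = + dist q q0 < k0 - k q

LatAdj : Pt → Pt → Set
LatAdj q r = dist q r ≡ 1

Fbd : (Pt → ℤ) → Pt → ℤ → Pt → Set
Fbd k q0 k0 q =
  (k0 ≡ k q0 × q ≡ q0) ⊎
  (k0 ≢ k q0 × ¬ Fint k q0 k0 q × Σ Pt λ r → LatAdj q r × Fint k q0 k0 r)

Fcl : (Pt → ℤ) → Pt → ℤ → Pt → Set
Fcl k q0 k0 q = Fint k q0 k0 q ⊎ Fbd k q0 k0 q

G-Vert : (Pt → ℤ) → Pt → ℤ → List Pt → Set
G-Edge : (Pt → ℤ) → Pt → ℤ → List Pt → List Pt → Set
G-Vert k q0 k0 = GenVert k (Fint k q0 k0)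
G-Edge k q0 k0 = GenEdge k (Fint k q0 k0)

Gbar-Vert : (Pt → ℤ) → Pt → ℤ → List Pt → Set
Gbar-Edge : (Pt → ℤ) → Pt → ℤ → List Pt → List Pt → Set
Gbar-Vert k q0 k0 = GenVert (kp k q0 k0) (Fcl k q0 k0)
Gbar-Edge k q0 k0 = GenEdge (kp k q0 k0) (Fcl k q0 k0)

-- The height function k of a stepped surface changes by exactly 1 along every lattice edge, and so
-- does proj_p; since p is odd, k and proj_p have the same parity everywhere, and then their minimum
-- k_p again changes by exactly 1 along lattice edges. For any height function h with this property
-- every unit square of Q_h is either flat (no diagonal) or cut by exactly one diagonal, and the
-- boundary of each of its faces is a directed cycle, so every face of Q_h is white or black. An
-- arrow has a unique orientation, hence the two faces on its sides have different colours: G_h and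
-- all its generated subgraphs are bipartite.
--
-- For connectivity, attach to each lattice point q the face of Q_h just above the lattice edge
-- from q to q + (1 , 0). Going around a corner q in S, and crossing arrows with an endpoint in S,
-- every face with corner q is joined to the face attached to q, and the faces attached to lattice
-- neighbours in S are joined to each other. So a generated subgraph is connected as soon as S is
-- connected in the lattice. F̊ is star-shaped about (i0 , j0): a unit step from a point of F̊
-- towards the centre lowers the distance by 1 and raises k by at most 1; every point of ∂F is the
-- centre or a lattice neighbour of F̊.
module Submission where

open import Defs
open import Data.Integer using (ℤ; _+_; _≤_)
open import Data.Product using (_×_; _,_)
open import Data.Integer using (+_; -[1+_]; _-_; _*_; -_; _<_; _>_; ∣_∣; _⊓_; _≟_)
import Data.Integer.Properties as ℤₚ
open import Data.Integer.Tactic.RingSolver using (solve-∀)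
open import Data.Nat as ℕ using (zero; suc)
import Data.Nat.Properties as ℕₚ
open import Data.Nat.Induction using (<-wellFounded)
open import Induction.WellFounded using (Acc; acc)
open import Data.Product using (Σ; proj₁; proj₂)
open import Data.Sum using (_⊎_; inj₁; inj₂)
import Data.Sum as Sum
open import Data.Empty using (⊥-elim)
open import Data.List using (List; []; _∷_)
open import Data.List.Relation.Unary.All using ([]; _∷_)
import Data.List.Relation.Unary.All as All
open import Data.List.Relation.Unary.Any using (Any; here; there)
open import Data.List.Membership.Propositional using (_∈_)
open import Relation.Nullary using (¬_; yes; no)
open import Relation.Binary.PropositionalEquality
open import Relation.Binary.Definitions using (tri<; tri≈; tri>)
open import Relation.Binary.Construct.Closure.ReflexiveTransitive using (Star; ε; _◅_; _◅◅_; reverse)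
import Relation.Binary.Construct.Closure.ReflexiveTransitive as Star
open import Relation.Binary.Construct.Closure.Symmetric using (SymClosure; fwd; bwd)
import Relation.Binary.Construct.Closure.Symmetric as SymClosure
open import Algebra.Properties.AbelianGroup ℤₚ.+-0-abelianGroup using (∙-cancelˡ; ∙-cancelʳ; inverseʳ-unique)

OneApart : ℤ → ℤ → Set
OneApart x y = x ≡ y + 1ℤ ⊎ y ≡ x + 1ℤ

OneApart-sym : ∀ {x y} → OneApart x y → OneApart y x
OneApart-sym (inj₁ e) = inj₂ e
OneApart-sym (inj₂ e) = inj₁ e

∣x-y∣≡1⇒OneApart : ∀ x y → ∣ x - y ∣ ≡ 1 → OneApart x y
∣x-y∣≡1⇒OneApart x y ∣x-y∣≡1 with x - y in eq
... | + 1 = inj₁ (trans (x≡y+[x-y] x y) (cong (λ d → y + d) eq))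
  where
  x≡y+[x-y] : ∀ x y → x ≡ y + (x - y)
  x≡y+[x-y] = solve-∀
... | -[1+ 0 ] = inj₂ (trans (y≡x-[x-y] x y) (cong (λ d → x - d) eq))
  where
  y≡x-[x-y] : ∀ x y → y ≡ x - (x - y)
  y≡x-[x-y] = solve-∀

OneApart⇒≤+1 : ∀ {x y} → OneApart x y → x ≤ y + 1ℤ
OneApart⇒≤+1 (inj₁ refl) = ℤₚ.≤-refl
OneApart⇒≤+1 {x} (inj₂ refl) = ℤₚ.≤-trans (ℤₚ.i≤i+j x 1ℤ) (ℤₚ.i≤i+j (x + 1ℤ) 1ℤ)

OneApart-midpoint : ∀ {b d x} → OneApart b x → OneApart d x → b ≢ d → b + d ≡ x + x
OneApart-midpoint (inj₁ refl) (inj₁ refl) b≢d = ⊥-elim (b≢d refl)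
OneApart-midpoint {d = d} (inj₁ refl) (inj₂ refl) _ = sum-of-neighbours d
  where
  sum-of-neighbours : ∀ d → ((d + 1ℤ) + 1ℤ) + d ≡ (d + 1ℤ) + (d + 1ℤ)
  sum-of-neighbours = solve-∀
OneApart-midpoint {b = b} (inj₂ refl) (inj₁ refl) _ = sum-of-neighbours b
  where
  sum-of-neighbours : ∀ b → b + ((b + 1ℤ) + 1ℤ) ≡ (b + 1ℤ) + (b + 1ℤ)
  sum-of-neighbours = solve-∀
OneApart-midpoint {b} {d} (inj₂ refl) (inj₂ e) b≢d = ⊥-elim (b≢d (∙-cancelʳ 1ℤ b d e))

x+x≡y+y⇒x≡y : ∀ {x y} → x + x ≡ y + y → x ≡ y
x+x≡y+y⇒x≡y {x} {y} e with ℤₚ.<-cmp x y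
... | tri< x<y _ _ = ⊥-elim (ℤₚ.<⇒≢ (ℤₚ.+-mono-< x<y x<y) e)
... | tri≈ _ x≡y _ = x≡y
... | tri> _ _ x>y = ⊥-elim (ℤₚ.<⇒≢ (ℤₚ.+-mono-< x>y x>y) (sym e))

x≡[x+1]-1 : ∀ x → x ≡ (x + 1ℤ) + - 1ℤ
x≡[x+1]-1 = solve-∀

x+1≢x-1 : ∀ x → x + 1ℤ ≢ x - 1ℤ
x+1≢x-1 x e with ∙-cancelˡ x 1ℤ (- 1ℤ) e
... | ()

x≡y+1⇒y<x : ∀ {x y} → x ≡ y + 1ℤ → y < x
x≡y+1⇒y<x {y = y} refl = ℤₚ.suc[i]≤j⇒i<j (ℤₚ.≤-reflexive (ℤₚ.+-comm 1ℤ y))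

x≡y+1⇒y≡x-1 : ∀ {x y} → x ≡ y + 1ℤ → y ≡ x - 1ℤ
x≡y+1⇒y≡x-1 {y = y} refl = x≡[x+1]-1 y

[x+1]+z≡[x+z]+1 : ∀ x z → (x + 1ℤ) + z ≡ (x + z) + 1ℤ
[x+1]+z≡[x+z]+1 = solve-∀

c-x≡[c-[x+1]]+1 : ∀ c x → c - x ≡ (c - (x + 1ℤ)) + 1ℤ
c-x≡[c-[x+1]]+1 = solve-∀

OneApart-+ʳ : ∀ z {x y} → OneApart x y → OneApart (x + z) (y + z)
OneApart-+ʳ z {y = y} (inj₁ refl) = inj₁ ([x+1]+z≡[x+z]+1 y z)
OneApart-+ʳ z {x} (inj₂ refl) = inj₂ ([x+1]+z≡[x+z]+1 x z)

OneApart-c- : ∀ c {x y} → OneApart x y → OneApart (c - x) (c - y)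
OneApart-c- c {y = y} (inj₁ refl) = inj₂ (c-x≡[c-[x+1]]+1 c y)
OneApart-c- c {x} (inj₂ refl) = inj₁ (c-x≡[c-[x+1]]+1 c x)

OneApart-∣z+1∣ : ∀ z → OneApart (+ ∣ z + 1ℤ ∣) (+ ∣ z ∣)
OneApart-∣z+1∣ (+ n) = inj₁ refl
OneApart-∣z+1∣ -[1+ zero ] = inj₂ refl
OneApart-∣z+1∣ -[1+ suc n ] = inj₂ (cong +_ (ℕₚ.+-comm 1 (suc n)))

-- Parity

Even : ℤ → Set
Even z = Σ ℤ λ w → z ≡ + 2 * w

IsOdd⇒Even-diff : ∀ {x y} → IsOdd x → IsOdd y → Even (x - y)
IsOdd⇒Even-diff (m , refl) (n , refl) = m - n , difference m n
  where
  difference : ∀ m n → (1ℤ + + 2 * m) - (1ℤ + + 2 * n) ≡ + 2 * (m - n)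
  difference = solve-∀

Even-+ : ∀ {x y} → Even x → Even y → Even (x + y)
Even-+ (v , refl) (w , refl) = v + w , sym (ℤₚ.*-distribˡ-+ (+ 2) v w)

Even-∣z∣-z : ∀ z → Even (+ ∣ z ∣ - z)
Even-∣z∣-z (+ n) = + 0 , ℤₚ.+-inverseʳ (+ n)
Even-∣z∣-z -[1+ n ] = + suc n , z-[-z]≡2z (+ suc n)
  where
  z-[-z]≡2z : ∀ z → z - (- z) ≡ + 2 * z
  z-[-z]≡2z = solve-∀

¬Even-1 : ¬ Even (- 1ℤ)
¬Even-1 (+ zero , ())
¬Even-1 (+ suc n , ())
¬Even-1 (-[1+ zero ] , ())
¬Even-1 (-[1+ suc n ] , ())

Even-diff-sym : ∀ {x y} → Even (x - y) → Even (y - x)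
Even-diff-sym {x} {y} (w , e) = - w , (begin
  y - x        ≡⟨ y-x≡-[x-y] x y ⟩
  - (x - y)    ≡⟨ cong -_ e ⟩
  - (+ 2 * w)  ≡⟨ ℤₚ.neg-distribʳ-* (+ 2) w ⟩
  + 2 * - w    ∎)
  where
  open ≡-Reasoning
  y-x≡-[x-y] : ∀ x y → y - x ≡ - (x - y)
  y-x≡-[x-y] = solve-∀

Even-diff⇒x+1<y : ∀ {x y} → Even (x - y) → x < y → x + 1ℤ < y
Even-diff⇒x+1<y {x} {y} ev x<y = ℤₚ.≤∧≢⇒< (subst (_≤ y) (ℤₚ.+-comm 1ℤ x) (ℤₚ.i<j⇒suc[i]≤j x<y)) x+1≢y
  where
  x-[x+1]≡-1 : ∀ x → x - (x + 1ℤ) ≡ - 1ℤ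
  x-[x+1]≡-1 = solve-∀
  x+1≢y : x + 1ℤ ≢ y
  x+1≢y refl = ¬Even-1 (subst Even (x-[x+1]≡-1 x) ev)

<+1⇒≤ : ∀ {x y} → x < y + 1ℤ → x ≤ y
<+1⇒≤ {x} {y} x<y+1 = subst (x ≤_) (pred[y+1]≡y y) (ℤₚ.i<j⇒i≤pred[j] x<y+1)
  where
  pred[y+1]≡y : ∀ y → - 1ℤ + (y + 1ℤ) ≡ y
  pred[y+1]≡y = solve-∀

neighbours-ordered : ∀ {x y x' y'} → Even (x - y) → x < y → OneApart x' x → OneApart y' y → x' ≤ y'
neighbours-ordered {x} {y} {x'} {y'} ev x<y x'~x y'~y =
  ℤₚ.≤-trans (OneApart⇒≤+1 x'~x) (x+1≤y' y'~y)
  where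
  x+1<y : x + 1ℤ < y
  x+1<y = Even-diff⇒x+1<y ev x<y
  x+1≤y' : OneApart y' y → x + 1ℤ ≤ y'
  x+1≤y' (inj₁ refl) = ℤₚ.≤-trans (ℤₚ.<⇒≤ x+1<y) (ℤₚ.i≤i+j y 1ℤ)
  x+1≤y' (inj₂ refl) = <+1⇒≤ x+1<y

⊓-OneApart : ∀ {x y x' y'} → Even (x - y) → OneApart x' x → OneApart y' y → OneApart (x' ⊓ y') (x ⊓ y)
⊓-OneApart {x} {y} {x'} {y'} ev x'~x y'~y with ℤₚ.<-cmp x y
... | tri< x<y _ _
  rewrite ℤₚ.i≤j⇒i⊓j≡i (neighbours-ordered ev x<y x'~x y'~y) | ℤₚ.i≤j⇒i⊓j≡i (ℤₚ.<⇒≤ x<y) = x'~x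
... | tri> _ _ y<x
  rewrite ℤₚ.i≥j⇒i⊓j≡j (neighbours-ordered (Even-diff-sym {x} {y} ev) y<x y'~y x'~x) | ℤₚ.i≥j⇒i⊓j≡j (ℤₚ.<⇒≤ y<x) = y'~y
... | tri≈ _ refl _ rewrite ℤₚ.⊓-idem x with ℤₚ.⊓-sel x' y'
...   | inj₁ e = subst (λ m → OneApart m x) (sym e) x'~x
...   | inj₂ e = subst (λ m → OneApart m x) (sym e) y'~y

UnitSteps : (Pt → ℤ) → Set
UnitSteps h = (∀ i j → OneApart (h (i + 1ℤ , j)) (h (i , j))) ×
              (∀ i j → OneApart (h (i , j + 1ℤ)) (h (i , j)))

SteppedSurface⇒UnitSteps : ∀ {k} → SteppedSurface k → UnitSteps k
SteppedSurface⇒UnitSteps (_ , stepH , stepV) =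
  (λ i j → ∣x-y∣≡1⇒OneApart _ _ (stepH i j)) , (λ i j → ∣x-y∣≡1⇒OneApart _ _ (stepV i j))

UnitSteps-⊓ : ∀ {f g} → UnitSteps f → UnitSteps g → (∀ q → Even (f q - g q)) → UnitSteps (λ q → f q ⊓ g q)
UnitSteps-⊓ (fH , fV) (gH , gV) ev =
  (λ i j → ⊓-OneApart (ev (i , j)) (fH i j) (gH i j)) , (λ i j → ⊓-OneApart (ev (i , j)) (fV i j) (gV i j))

proj-UnitSteps : ∀ c k0 → UnitSteps (proj c k0)
proj-UnitSteps (i0 , j0) k0 = along-i , along-j
  where
  vary-summand : ∀ {m m'} n → OneApart (+ m') (+ m) → OneApart (k0 - + (m' ℕ.+ n)) (k0 - + (m ℕ.+ n))
  vary-summand {m} {m'} n m'~m rewrite ℤₚ.pos-+ m' n | ℤₚ.pos-+ m n = OneApart-c- k0 (OneApart-+ʳ (+ n) m'~m)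
  shift : ∀ x x0 → (x + 1ℤ) - x0 ≡ (x - x0) + 1ℤ
  shift = solve-∀
  along-i : ∀ i j → OneApart (proj (i0 , j0) k0 (i + 1ℤ , j)) (proj (i0 , j0) k0 (i , j))
  along-i i j rewrite shift i i0 = vary-summand ∣ j - j0 ∣ (OneApart-∣z+1∣ (i - i0))
  along-j : ∀ i j → OneApart (proj (i0 , j0) k0 (i , j + 1ℤ)) (proj (i0 , j0) k0 (i , j))
  along-j i j rewrite shift j j0 | ℕₚ.+-comm ∣ i - i0 ∣ ∣ (j - j0) + 1ℤ ∣ | ℕₚ.+-comm ∣ i - i0 ∣ ∣ j - j0 ∣ =
    vary-summand ∣ i - i0 ∣ (OneApart-∣z+1∣ (j - j0))

Even-k-proj : ∀ {k : Pt → ℤ} i0 j0 k0 → IsOdd (i0 + j0 + k0) → (∀ i j → IsOdd (i + j + k (i , j))) →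
  ∀ q → Even (k q - proj (i0 , j0) k0 q)
Even-k-proj {k} i0 j0 k0 odd-p odd-k (i , j) =
  subst Even (sym regroup)
    (Even-+ {(i + j + k (i , j)) - (i0 + j0 + k0)} (IsOdd⇒Even-diff (odd-k i j) odd-p)
            (Even-+ (Even-∣z∣-z (i - i0)) (Even-∣z∣-z (j - j0))))
  where
  identity : ∀ i j kq i0 j0 k0 a b →
    kq - (k0 - (a + b)) ≡ ((i + j + kq) - (i0 + j0 + k0)) + ((a - (i - i0)) + (b - (j - j0)))
  identity = solve-∀
  regroup : k (i , j) - proj (i0 , j0) k0 (i , j) ≡
    ((i + j + k (i , j)) - (i0 + j0 + k0)) + ((+ ∣ i - i0 ∣ - (i - i0)) + (+ ∣ j - j0 ∣ - (j - j0)))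
  regroup = trans (cong (λ d → k (i , j) - (k0 - d)) (ℤₚ.pos-+ ∣ i - i0 ∣ ∣ j - j0 ∣))
                  (identity i j (k (i , j)) i0 j0 k0 (+ ∣ i - i0 ∣) (+ ∣ j - j0 ∣))

-- Lattice paths

data Step : Pt → Pt → Set where
  horizontal : ∀ {i i' j} → OneApart i' i → Step (i , j) (i' , j)
  vertical : ∀ {i j j'} → OneApart j' j → Step (i , j) (i , j')

Path : (Pt → Set) → Pt → Pt → Set
Path S = Star (λ q r → Step q r × S q × S r)

∣-[1+n]+1∣≡n : ∀ n → ∣ -[1+ n ] + 1ℤ ∣ ≡ n
∣-[1+n]+1∣≡n zero = refl
∣-[1+n]+1∣≡n (suc n) = refl

step-toward : ∀ x c → x ≢ c → Σ ℤ λ y → OneApart y x × suc ∣ y - c ∣ ≡ ∣ x - c ∣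
step-toward x c x≢c with x - c in eq
... | + zero = ⊥-elim (x≢c (ℤₚ.i-j≡0⇒i≡j x c eq))
... | + suc n = x - 1ℤ , inj₂ (x≡[x-1]+1 x) , cong (λ z → suc ∣ z ∣) (trans (shift x c) (cong (_- 1ℤ) eq))
  where
  x≡[x-1]+1 : ∀ x → x ≡ (x - 1ℤ) + 1ℤ
  x≡[x-1]+1 = solve-∀
  shift : ∀ x c → (x - 1ℤ) - c ≡ (x - c) - 1ℤ
  shift = solve-∀
... | -[1+ n ] = x + 1ℤ , inj₁ refl ,
  cong suc (trans (cong ∣_∣ (trans (shift x c) (cong (_+ 1ℤ) eq))) (∣-[1+n]+1∣≡n n))
  where
  shift : ∀ x c → (x + 1ℤ) - c ≡ (x - c) + 1ℤ
  shift = solve-∀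

closer-neighbour : ∀ q c → q ≡ c ⊎ Σ Pt λ r → Step q r × suc (dist r c) ≡ dist q c
closer-neighbour (i , j) (i0 , j0) with i ≟ i0
... | no i≢i0 with step-toward i i0 i≢i0
...   | y , y~i , closer = inj₂ ((y , j) , horizontal y~i , cong (ℕ._+ ∣ j - j0 ∣) closer)
closer-neighbour (i , j) (i , j0) | yes refl with j ≟ j0
...   | yes refl = inj₁ refl
...   | no j≢j0 with step-toward j j0 j≢j0
...     | y , y~j , closer =
  inj₂ ((i , y) , vertical y~j , trans (sym (ℕₚ.+-suc ∣ i - i ∣ ∣ y - j0 ∣)) (cong (∣ i - i ∣ ℕ.+_) closer))

path-to-centre : ∀ {S : Pt → Set} c →
  (∀ q → S q → q ≡ c ⊎ Σ Pt λ r → Step q r × dist r c ℕ.< dist q c × S r) →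
  ∀ q → S q → Path S q c
path-to-centre {S} c closer q Sq = go q Sq (<-wellFounded (dist q c))
  where
  go : ∀ q → S q → Acc ℕ._<_ (dist q c) → Path S q c
  go q Sq (acc smaller) with closer q Sq
  ... | inj₁ refl = ε
  ... | inj₂ (r , q→r , r<q , Sr) = (q→r , Sq , Sr) ◅ go r Sr (smaller r<q)

Step-OneApart : ∀ {h} → UnitSteps h → ∀ {q r} → Step q r → OneApart (h r) (h q)
Step-OneApart (stepH , _) {i , j} (horizontal (inj₁ refl)) = stepH i j
Step-OneApart (stepH , _) {_ , j} {i' , _} (horizontal (inj₂ refl)) = OneApart-sym (stepH i' j)
Step-OneApart (_ , stepV) {i , j} (vertical (inj₁ refl)) = stepV i j
Step-OneApart (_ , stepV) {i , _} {_ , j'} (vertical (inj₂ refl)) = OneApart-sym (stepV i j')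

LatAdj⇒Step : ∀ {q r} → LatAdj q r → Step q r
LatAdj⇒Step {i , j} {i' , j'} adj with ∣ i - i' ∣ in di | ∣ j - j' ∣ in dj
... | 0 | 1 = vertical-at (ℤₚ.i-j≡0⇒i≡j i i' (ℤₚ.∣i∣≡0⇒i≡0 di)) (OneApart-sym (∣x-y∣≡1⇒OneApart j j' dj))
  where
  vertical-at : ∀ {i i' j j'} → i ≡ i' → OneApart j' j → Step (i , j) (i' , j')
  vertical-at refl = vertical
... | 1 | 0 = horizontal-at (ℤₚ.i-j≡0⇒i≡j j j' (ℤₚ.∣i∣≡0⇒i≡0 dj)) (OneApart-sym (∣x-y∣≡1⇒OneApart i i' di))
  where
  horizontal-at : ∀ {i i' j j'} → j ≡ j' → OneApart i' i → Step (i , j) (i' , j')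
  horizontal-at refl = horizontal

-- Arrows have a unique orientation

_⊕_ : Pt → Pt → Pt
(a , b) ⊕ (c , d) = (a + c , b + d)

⊖_ : Pt → Pt
⊖ (a , b) = (- a , - b)

⊕-inverse-unique : ∀ u p q → u ≡ (u ⊕ p) ⊕ q → q ≡ ⊖ p
⊕-inverse-unique (a , b) (p₁ , p₂) (q₁ , q₂) e =
  cong₂ _,_ (coordinate a p₁ q₁ (cong proj₁ e)) (coordinate b p₂ q₂ (cong proj₂ e))
  where
  coordinate : ∀ x p q → x ≡ (x + p) + q → q ≡ - p
  coordinate x p q e = inverseʳ-unique p q
    (∙-cancelˡ x (p + q) (+ 0) (trans (sym (ℤₚ.+-assoc x p q)) (trans (sym e) (sym (ℤₚ.+-identityʳ x)))))

data Dir : Set where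
  east west north south northeast southwest southeast northwest : Dir

disp : Dir → Pt
disp east = (+ 1 , + 0)
disp west = (- + 1 , + 0)
disp north = (+ 0 , + 1)
disp south = (+ 0 , - + 1)
disp northeast = (+ 1 , + 1)
disp southwest = (- + 1 , - + 1)
disp southeast = (+ 1 , - + 1)
disp northwest = (- + 1 , + 1)

-- a left inverse of disp; its value off the eight unit displacements is irrelevant
direction : Pt → Dir
direction (+ 1 , + 0) = east
direction (-[1+ 0 ] , + 0) = west
direction (+ 0 , + 1) = north
direction (+ 0 , -[1+ 0 ]) = south
direction (+ 1 , + 1) = northeast
direction (-[1+ 0 ] , -[1+ 0 ]) = southwest
direction (+ 1 , -[1+ 0 ]) = southeast
direction (-[1+ 0 ] , + 1) = northwest
direction _ = east

direction-disp : ∀ d → direction (disp d) ≡ d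
direction-disp east = refl
direction-disp west = refl
direction-disp north = refl
direction-disp south = refl
direction-disp northeast = refl
direction-disp southwest = refl
direction-disp southeast = refl
direction-disp northwest = refl

opposite : Dir → Dir
opposite d = direction (⊖ disp d)

source target : Dir → ℤ → ℤ → Pt
source east i j = (i , j)
source west i j = (i + 1ℤ , j)
source north i j = (i , j)
source south i j = (i , j + 1ℤ)
source northeast i j = (i , j)
source southwest i j = (i + 1ℤ , j + 1ℤ)
source southeast i j = (i , j + 1ℤ)
source northwest i j = (i + 1ℤ , j)
target east i j = (i + 1ℤ , j)
target west i j = (i , j)
target north i j = (i , j + 1ℤ)
target south i j = (i , j)
target northeast i j = (i + 1ℤ , j + 1ℤ)
target southwest i j = (i , j)
target southeast i j = (i + 1ℤ , j)
target northwest i j = (i , j + 1ℤ)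

target≡source⊕disp : ∀ d i j → target d i j ≡ source d i j ⊕ disp d
target≡source⊕disp east i j = cong (i + 1ℤ ,_) (sym (ℤₚ.+-identityʳ j))
target≡source⊕disp west i j = cong₂ _,_ (x≡[x+1]-1 i) (sym (ℤₚ.+-identityʳ j))
target≡source⊕disp north i j = cong (_, j + 1ℤ) (sym (ℤₚ.+-identityʳ i))
target≡source⊕disp south i j = cong₂ _,_ (sym (ℤₚ.+-identityʳ i)) (x≡[x+1]-1 j)
target≡source⊕disp northeast i j = refl
target≡source⊕disp southwest i j = cong₂ _,_ (x≡[x+1]-1 i) (x≡[x+1]-1 j)
target≡source⊕disp southeast i j = cong (i + 1ℤ ,_) (x≡[x+1]-1 j)
target≡source⊕disp northwest i j = cong (_, j + 1ℤ) (x≡[x+1]-1 i)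

reversed-direction : ∀ d d' i j i' j' → target d i j ≡ source d' i' j' → source d i j ≡ target d' i' j' →
  d' ≡ opposite d
reversed-direction d d' i j i' j' v≡ u≡ =
  trans (sym (direction-disp d')) (cong direction (⊕-inverse-unique _ (disp d) (disp d') loop))
  where
  open ≡-Reasoning
  loop : source d i j ≡ (source d i j ⊕ disp d) ⊕ disp d'
  loop = begin
    source d i j                      ≡⟨ u≡ ⟩
    target d' i' j'                   ≡⟨ target≡source⊕disp d' i' j' ⟩
    source d' i' j' ⊕ disp d'         ≡⟨ cong (_⊕ disp d') (sym v≡) ⟩
    target d i j ⊕ disp d'            ≡⟨ cong (_⊕ disp d') (target≡source⊕disp d i j) ⟩
    (source d i j ⊕ disp d) ⊕ disp d' ∎

module _ (h : Pt → ℤ) where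

  ArrowCondition : Dir → ℤ → ℤ → Set
  ArrowCondition east i j = h (i , j) > h (i + 1ℤ , j)
  ArrowCondition west i j = h (i + 1ℤ , j) > h (i , j)
  ArrowCondition north i j = h (i , j) < h (i , j + 1ℤ)
  ArrowCondition south i j = h (i , j + 1ℤ) < h (i , j)
  ArrowCondition northeast i j = h (i + 1ℤ , j) ≡ h (i , j) + 1ℤ
  ArrowCondition southwest i j = h (i + 1ℤ , j) ≡ h (i , j) - 1ℤ
  ArrowCondition southeast i j = h (i , j) ≡ h (i + 1ℤ , j) - 1ℤ
  ArrowCondition northwest i j = h (i , j) ≡ h (i + 1ℤ , j) + 1ℤ

  -- Agda cannot unify indices such as i + 1ℤ, so two arrows are compared through their directions
  -- and base squares rather than by matching on both.
  ArrowView : Pt → Pt → Set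
  ArrowView u v = Σ Dir λ d → Σ ℤ λ i → Σ ℤ λ j →
    u ≡ source d i j × v ≡ target d i j × ArrowCondition d i j

  arrowView : ∀ {u v} → Arrow h u v → ArrowView u v
  arrowView (horR {i} {j} c) = east , i , j , refl , refl , c
  arrowView (horL {i} {j} c) = west , i , j , refl , refl , c
  arrowView (verU {i} {j} c) = north , i , j , refl , refl , c
  arrowView (verD {i} {j} c) = south , i , j , refl , refl , c
  arrowView (diagAC {i} {j} _ _ c) = northeast , i , j , refl , refl , c
  arrowView (diagCA {i} {j} _ _ c) = southwest , i , j , refl , refl , c
  arrowView (diagDB {i} {j} _ _ c) = southeast , i , j , refl , refl , c
  arrowView (diagBD {i} {j} _ _ c) = northwest , i , j , refl , refl , c

  opposite-conditions : ∀ d i j i' j' →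
    source d i j ≡ target (opposite d) i' j' → target d i j ≡ source (opposite d) i' j' →
    ArrowCondition d i j → ¬ ArrowCondition (opposite d) i' j'
  opposite-conditions east i j _ _ refl _ c c' = ℤₚ.<-asym c c'
  opposite-conditions west i j _ _ _ refl c c' = ℤₚ.<-asym c c'
  opposite-conditions north i j _ _ refl _ c c' = ℤₚ.<-asym c c'
  opposite-conditions south i j _ _ _ refl c c' = ℤₚ.<-asym c c'
  opposite-conditions northeast i j _ _ refl _ c c' = x+1≢x-1 (h (i , j)) (trans (sym c) c')
  opposite-conditions southwest i j _ _ _ refl c c' = x+1≢x-1 (h (i , j)) (trans (sym c') c)
  opposite-conditions southeast i j i' j' e e' c c' with cong proj₁ e | cong proj₂ e'
  ... | refl | refl = x+1≢x-1 (h (i + 1ℤ , j)) (trans (sym c') c)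
  opposite-conditions northwest i j i' j' e e' c c' with cong proj₂ e | cong proj₁ e'
  ... | refl | refl = x+1≢x-1 (h (i + 1ℤ , j)) (trans (sym c) c')

  Arrow-asym : ∀ {u v} → Arrow h u v → ¬ Arrow h v u
  Arrow-asym u→v v→u with arrowView u→v | arrowView v→u
  ... | d , i , j , refl , refl , c | d' , i' , j' , v≡ , u≡ , c' with reversed-direction d d' i j i' j' v≡ u≡
  ... | refl = opposite-conditions d i j i' j' u≡ v≡ c c'

-- Faces of Q_h and their colours

-- The unit square at (a , b) has corners A = (a , b), B = (a + 1 , b), C = (a + 1 , b + 1) and
-- D = (a , b + 1), as in the definition of Q_h.
data Side : Set where
  AB BC CD DA : Side

corners□ cornersABC cornersACD cornersABD cornersBCD : ℤ → ℤ → List Pt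
corners□ a b = (a , b) ∷ (a + 1ℤ , b) ∷ (a + 1ℤ , b + 1ℤ) ∷ (a , b + 1ℤ) ∷ []
cornersABC a b = (a , b) ∷ (a + 1ℤ , b) ∷ (a + 1ℤ , b + 1ℤ) ∷ []
cornersACD a b = (a , b) ∷ (a + 1ℤ , b + 1ℤ) ∷ (a , b + 1ℤ) ∷ []
cornersABD a b = (a , b) ∷ (a + 1ℤ , b) ∷ (a , b + 1ℤ) ∷ []
cornersBCD a b = (a + 1ℤ , b) ∷ (a + 1ℤ , b + 1ℤ) ∷ (a , b + 1ℤ) ∷ []

sideEdge : Side → ℤ → ℤ → Pt × Pt
sideEdge AB a b = (a , b) , (a + 1ℤ , b)
sideEdge BC a b = (a + 1ℤ , b) , (a + 1ℤ , b + 1ℤ)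
sideEdge CD a b = (a + 1ℤ , b + 1ℤ) , (a , b + 1ℤ)
sideEdge DA a b = (a , b + 1ℤ) , (a , b)

module FaceGraph {h : Pt → ℤ} (steps : UnitSteps h) where

  stepH : ∀ i j → OneApart (h (i + 1ℤ , j)) (h (i , j))
  stepH = proj₁ steps

  stepV : ∀ i j → OneApart (h (i , j + 1ℤ)) (h (i , j))
  stepV = proj₂ steps

  data SquareShape (a b : ℤ) : Set where
    flat : h (a , b) ≡ h (a + 1ℤ , b + 1ℤ) → h (a + 1ℤ , b) ≡ h (a , b + 1ℤ) → SquareShape a b
    cutAC : h (a , b) ≡ h (a + 1ℤ , b + 1ℤ) → h (a + 1ℤ , b) ≢ h (a , b + 1ℤ) → SquareShape a b
    cutBD : h (a + 1ℤ , b) ≡ h (a , b + 1ℤ) → h (a , b) ≢ h (a + 1ℤ , b + 1ℤ) → SquareShape a b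

  -- If h B ≢ h D, then h B and h D are x - 1 and x + 1 both for x = h A and for x = h C.
  level-diagonal : ∀ a b → h (a + 1ℤ , b) ≢ h (a , b + 1ℤ) → h (a , b) ≡ h (a + 1ℤ , b + 1ℤ)
  level-diagonal a b B≢D = x+x≡y+y⇒x≡y (trans (sym (OneApart-midpoint (stepH a b) (stepV a b) B≢D))
    (OneApart-midpoint (OneApart-sym (stepV (a + 1ℤ) b)) (OneApart-sym (stepH a (b + 1ℤ))) B≢D))

  shape : ∀ a b → SquareShape a b
  shape a b with h (a , b) ≟ h (a + 1ℤ , b + 1ℤ) | h (a + 1ℤ , b) ≟ h (a , b + 1ℤ)
  ... | yes A≡C | yes B≡D = flat A≡C B≡D
  ... | yes A≡C | no B≢D = cutAC A≡C B≢D
  ... | no A≢C | yes B≡D = cutBD B≡D A≢C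
  ... | no A≢C | no B≢D = ⊥-elim (A≢C (level-diagonal a b B≢D))

  face : ∀ {a b} → SquareShape a b → Side → List Pt
  face {a} {b} (flat _ _) _ = corners□ a b
  face {a} {b} (cutAC _ _) AB = cornersABC a b
  face {a} {b} (cutAC _ _) BC = cornersABC a b
  face {a} {b} (cutAC _ _) CD = cornersACD a b
  face {a} {b} (cutAC _ _) DA = cornersACD a b
  face {a} {b} (cutBD _ _) AB = cornersABD a b
  face {a} {b} (cutBD _ _) BC = cornersBCD a b
  face {a} {b} (cutBD _ _) CD = cornersBCD a b
  face {a} {b} (cutBD _ _) DA = cornersABD a b

  face-isFace : ∀ {a b} (t : SquareShape a b) s → Face h (face t s)
  face-isFace (flat A≡C B≡D) _ = square A≡C B≡D
  face-isFace (cutAC A≡C B≢D) AB = triABC A≡C B≢D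
  face-isFace (cutAC A≡C B≢D) BC = triABC A≡C B≢D
  face-isFace (cutAC A≡C B≢D) CD = triACD A≡C B≢D
  face-isFace (cutAC A≡C B≢D) DA = triACD A≡C B≢D
  face-isFace (cutBD B≡D A≢C) AB = triABD B≡D A≢C
  face-isFace (cutBD B≡D A≢C) BC = triBCD B≡D A≢C
  face-isFace (cutBD B≡D A≢C) CD = triBCD B≡D A≢C
  face-isFace (cutBD B≡D A≢C) DA = triABD B≡D A≢C

  sideEdge∈face : ∀ {a b} (t : SquareShape a b) s → sideEdge s a b ∈ cycPairs (face t s)
  sideEdge∈face (flat _ _) AB = here refl
  sideEdge∈face (flat _ _) BC = there (here refl)
  sideEdge∈face (flat _ _) CD = there (there (here refl))
  sideEdge∈face (flat _ _) DA = there (there (there (here refl)))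
  sideEdge∈face (cutAC _ _) AB = here refl
  sideEdge∈face (cutAC _ _) BC = there (here refl)
  sideEdge∈face (cutAC _ _) CD = there (here refl)
  sideEdge∈face (cutAC _ _) DA = there (there (here refl))
  sideEdge∈face (cutBD _ _) AB = here refl
  sideEdge∈face (cutBD _ _) BC = here refl
  sideEdge∈face (cutBD _ _) CD = there (here refl)
  sideEdge∈face (cutBD _ _) DA = there (there (here refl))

  faceAB-unique : ∀ {a b} (t t' : SquareShape a b) → face t AB ≡ face t' AB
  faceAB-unique (flat _ _) (flat _ _) = refl
  faceAB-unique (flat _ B≡D) (cutAC _ B≢D) = ⊥-elim (B≢D B≡D)
  faceAB-unique (flat A≡C _) (cutBD _ A≢C) = ⊥-elim (A≢C A≡C)
  faceAB-unique (cutAC _ B≢D) (flat _ B≡D) = ⊥-elim (B≢D B≡D)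
  faceAB-unique (cutAC _ _) (cutAC _ _) = refl
  faceAB-unique (cutAC A≡C _) (cutBD _ A≢C) = ⊥-elim (A≢C A≡C)
  faceAB-unique (cutBD _ A≢C) (flat A≡C _) = ⊥-elim (A≢C A≡C)
  faceAB-unique (cutBD _ A≢C) (cutAC A≡C _) = ⊥-elim (A≢C A≡C)
  faceAB-unique (cutBD _ _) (cutBD _ _) = refl

  face-colour : ∀ {f} → Face h f → White h f ⊎ Black h f
  face-colour F@(square {a} {b} A≡C B≡D) with stepH a b
  ... | inj₁ B≡A+1 = inj₂ (F , horL A<B ∷ verD (subst (_< h (a + 1ℤ , b)) A≡C A<B) ∷
                                horR (subst₂ _<_ A≡C B≡D A<B) ∷ verU (subst (h (a , b) <_) B≡D A<B) ∷ [])
    where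
    A<B : h (a , b) < h (a + 1ℤ , b)
    A<B = x≡y+1⇒y<x B≡A+1
  ... | inj₂ A≡B+1 = inj₁ (F , horR B<A ∷ verU (subst (h (a + 1ℤ , b) <_) A≡C B<A) ∷
                                horL (subst₂ _<_ B≡D A≡C B<A) ∷ verD (subst (_< h (a , b)) B≡D B<A) ∷ [])
    where
    B<A : h (a + 1ℤ , b) < h (a , b)
    B<A = x≡y+1⇒y<x A≡B+1
  face-colour F@(triABC {a} {b} A≡C B≢D) with stepH a b
  ... | inj₁ B≡A+1 = inj₂ (F , horL A<B ∷ verD (subst (_< h (a + 1ℤ , b)) A≡C A<B) ∷
                                diagAC A≡C B≢D B≡A+1 ∷ [])
    where
    A<B : h (a , b) < h (a + 1ℤ , b)
    A<B = x≡y+1⇒y<x B≡A+1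
  ... | inj₂ A≡B+1 = inj₁ (F , horR B<A ∷ verU (subst (h (a + 1ℤ , b) <_) A≡C B<A) ∷
                                diagCA A≡C B≢D (x≡y+1⇒y≡x-1 A≡B+1) ∷ [])
    where
    B<A : h (a + 1ℤ , b) < h (a , b)
    B<A = x≡y+1⇒y<x A≡B+1
  face-colour F@(triACD {a} {b} A≡C B≢D) with stepH a b | stepV a b
  ... | inj₁ B≡A+1 | inj₁ D≡A+1 = ⊥-elim (B≢D (trans B≡A+1 (sym D≡A+1)))
  ... | inj₁ B≡A+1 | inj₂ A≡D+1 = inj₁ (F , diagAC A≡C B≢D B≡A+1 ∷
                                          horL (subst (h (a , b + 1ℤ) <_) A≡C D<A) ∷ verD D<A ∷ [])
    where
    D<A : h (a , b + 1ℤ) < h (a , b)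
    D<A = x≡y+1⇒y<x A≡D+1
  ... | inj₂ A≡B+1 | inj₁ D≡A+1 = inj₂ (F , diagCA A≡C B≢D (x≡y+1⇒y≡x-1 A≡B+1) ∷
                                          horR (subst (_< h (a , b + 1ℤ)) A≡C A<D) ∷ verU A<D ∷ [])
    where
    A<D : h (a , b) < h (a , b + 1ℤ)
    A<D = x≡y+1⇒y<x D≡A+1
  ... | inj₂ A≡B+1 | inj₂ A≡D+1 = ⊥-elim (B≢D (∙-cancelʳ 1ℤ _ _ (trans (sym A≡B+1) A≡D+1)))
  face-colour F@(triABD {a} {b} B≡D A≢C) with stepH a b
  ... | inj₁ B≡A+1 = inj₂ (F , horL A<B ∷ diagDB B≡D A≢C (x≡y+1⇒y≡x-1 B≡A+1) ∷
                                verU (subst (h (a , b) <_) B≡D A<B) ∷ [])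
    where
    A<B : h (a , b) < h (a + 1ℤ , b)
    A<B = x≡y+1⇒y<x B≡A+1
  ... | inj₂ A≡B+1 = inj₁ (F , horR B<A ∷ diagBD B≡D A≢C A≡B+1 ∷
                                verD (subst (_< h (a , b)) B≡D B<A) ∷ [])
    where
    B<A : h (a + 1ℤ , b) < h (a , b)
    B<A = x≡y+1⇒y<x A≡B+1
  face-colour F@(triBCD {a} {b} B≡D A≢C) with stepH a b | stepV (a + 1ℤ) b
  ... | inj₁ B≡A+1 | inj₁ C≡B+1 = inj₁ (F , verU B<C ∷ horL (subst (_< h (a + 1ℤ , b + 1ℤ)) B≡D B<C) ∷
                                          diagDB B≡D A≢C (x≡y+1⇒y≡x-1 B≡A+1) ∷ [])
    where
    B<C : h (a + 1ℤ , b) < h (a + 1ℤ , b + 1ℤ)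
    B<C = x≡y+1⇒y<x C≡B+1
  ... | inj₂ A≡B+1 | inj₂ B≡C+1 = inj₂ (F , verD C<B ∷ horR (subst (h (a + 1ℤ , b + 1ℤ) <_) B≡D C<B) ∷
                                          diagBD B≡D A≢C A≡B+1 ∷ [])
    where
    C<B : h (a + 1ℤ , b + 1ℤ) < h (a + 1ℤ , b)
    C<B = x≡y+1⇒y<x B≡C+1
  ... | inj₁ B≡A+1 | inj₂ B≡C+1 = ⊥-elim (A≢C (∙-cancelʳ 1ℤ _ _ (trans (sym B≡A+1) B≡C+1)))
  ... | inj₂ A≡B+1 | inj₁ C≡B+1 = ⊥-elim (A≢C (trans A≡B+1 (sym C≡B+1)))

  edge-colour : ∀ {S f g} → GenEdge h S f g → (White h f × Black h g) ⊎ (Black h f × White h g)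
  edge-colour (_ , _ , u→v , _ , Ff , Fg , uv∈f , vu∈g) with face-colour Ff | face-colour Fg
  ... | inj₁ white-f | inj₂ black-g = inj₁ (white-f , black-g)
  ... | inj₂ black-f | inj₁ white-g = inj₂ (black-f , white-g)
  ... | inj₁ _ | inj₁ (_ , arrows-g) = ⊥-elim (Arrow-asym h u→v (All.lookup arrows-g vu∈g))
  ... | inj₂ (_ , arrows-f) | inj₂ _ = ⊥-elim (Arrow-asym h u→v (All.lookup arrows-f uv∈f))

  GenGraph-bipartite : ∀ S → Bipartite h (GenVert h S) (GenEdge h S)
  GenGraph-bipartite S = (λ _ (F , _) → face-colour F) , (λ _ _ → edge-colour)

  module Connectivity (S : Pt → Set) where

    Walk : List Pt → List Pt → Set
    Walk = Star (SymClosure (GenEdge h S))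

    reverse-walk : ∀ {f g} → Walk f g → Walk g f
    reverse-walk = reverse (SymClosure.symmetric _)

    cross : ∀ {f g u v} → Face h f → Face h g → (u , v) ∈ cycPairs f → (v , u) ∈ cycPairs g →
            Arrow h u v ⊎ Arrow h v u → S u ⊎ S v → Walk f g
    cross Ff Fg uv∈f vu∈g (inj₁ u→v) Su⊎Sv = fwd (_ , _ , u→v , Su⊎Sv , Ff , Fg , uv∈f , vu∈g) ◅ ε
    cross Ff Fg uv∈f vu∈g (inj₂ v→u) Su⊎Sv = bwd (_ , _ , v→u , Sum.swap Su⊎Sv , Fg , Ff , vu∈g , uv∈f) ◅ ε

    horizontal-arrow : ∀ a b → Arrow h (a , b) (a + 1ℤ , b) ⊎ Arrow h (a + 1ℤ , b) (a , b)
    horizontal-arrow a b with stepH a b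
    ... | inj₁ B≡A+1 = inj₂ (horL (x≡y+1⇒y<x B≡A+1))
    ... | inj₂ A≡B+1 = inj₁ (horR (x≡y+1⇒y<x A≡B+1))

    vertical-arrow : ∀ a b → Arrow h (a , b) (a , b + 1ℤ) ⊎ Arrow h (a , b + 1ℤ) (a , b)
    vertical-arrow a b with stepV a b
    ... | inj₁ D≡A+1 = inj₁ (verU (x≡y+1⇒y<x D≡A+1))
    ... | inj₂ A≡D+1 = inj₂ (verD (x≡y+1⇒y<x A≡D+1))

    diagonalAC-arrow : ∀ {a b} → h (a , b) ≡ h (a + 1ℤ , b + 1ℤ) → h (a + 1ℤ , b) ≢ h (a , b + 1ℤ) →
              Arrow h (a , b) (a + 1ℤ , b + 1ℤ) ⊎ Arrow h (a + 1ℤ , b + 1ℤ) (a , b)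
    diagonalAC-arrow {a} {b} A≡C B≢D with stepH a b
    ... | inj₁ B≡A+1 = inj₁ (diagAC A≡C B≢D B≡A+1)
    ... | inj₂ A≡B+1 = inj₂ (diagCA A≡C B≢D (x≡y+1⇒y≡x-1 A≡B+1))

    diagonalBD-arrow : ∀ {a b} → h (a + 1ℤ , b) ≡ h (a , b + 1ℤ) → h (a , b) ≢ h (a + 1ℤ , b + 1ℤ) →
              Arrow h (a + 1ℤ , b) (a , b + 1ℤ) ⊎ Arrow h (a , b + 1ℤ) (a + 1ℤ , b)
    diagonalBD-arrow {a} {b} B≡D A≢C with stepH a b
    ... | inj₁ B≡A+1 = inj₂ (diagDB B≡D A≢C (x≡y+1⇒y≡x-1 B≡A+1))
    ... | inj₂ A≡B+1 = inj₁ (diagBD B≡D A≢C A≡B+1)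

    around-A : ∀ {a b} (t : SquareShape a b) → S (a , b) → Walk (face t DA) (face t AB)
    around-A (flat _ _) _ = ε
    around-A (cutAC A≡C B≢D) SA = cross (triACD A≡C B≢D) (triABC A≡C B≢D) (here refl) (there (there (here refl)))
                                       (diagonalAC-arrow A≡C B≢D) (inj₁ SA)
    around-A (cutBD _ _) _ = ε

    around-B : ∀ {a b} (t : SquareShape a b) → S (a + 1ℤ , b) → Walk (face t AB) (face t BC)
    around-B (flat _ _) _ = ε
    around-B (cutAC _ _) _ = ε
    around-B (cutBD B≡D A≢C) SB = cross (triABD B≡D A≢C) (triBCD B≡D A≢C) (there (here refl)) (there (there (here refl)))
                                       (diagonalBD-arrow B≡D A≢C) (inj₁ SB)

    around-C : ∀ {a b} (t : SquareShape a b) → S (a + 1ℤ , b + 1ℤ) → Walk (face t BC) (face t CD)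
    around-C (flat _ _) _ = ε
    around-C (cutAC A≡C B≢D) SC = cross (triABC A≡C B≢D) (triACD A≡C B≢D) (there (there (here refl))) (here refl)
                                       (Sum.swap (diagonalAC-arrow A≡C B≢D)) (inj₁ SC)
    around-C (cutBD _ _) _ = ε

    around-D : ∀ {a b} (t : SquareShape a b) → S (a , b + 1ℤ) → Walk (face t CD) (face t DA)
    around-D (flat _ _) _ = ε
    around-D (cutAC _ _) _ = ε
    around-D (cutBD B≡D A≢C) SD = cross (triBCD B≡D A≢C) (triABD B≡D A≢C) (there (there (here refl))) (there (here refl))
                                       (Sum.swap (diagonalBD-arrow B≡D A≢C)) (inj₁ SD)

    across-BC : ∀ {a b} (t : SquareShape a b) (t' : SquareShape (a + 1ℤ) b) →
                S (a + 1ℤ , b) ⊎ S (a + 1ℤ , b + 1ℤ) → Walk (face t BC) (face t' DA)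
    across-BC {a} {b} t t' = cross (face-isFace t BC) (face-isFace t' DA) (sideEdge∈face t BC) (sideEdge∈face t' DA)
                                   (vertical-arrow (a + 1ℤ) b)

    across-CD : ∀ {a b} (t : SquareShape a b) (t' : SquareShape a (b + 1ℤ)) →
                S (a + 1ℤ , b + 1ℤ) ⊎ S (a , b + 1ℤ) → Walk (face t CD) (face t' AB)
    across-CD {a} {b} t t' = cross (face-isFace t CD) (face-isFace t' AB) (sideEdge∈face t CD) (sideEdge∈face t' AB)
                                   (Sum.swap (horizontal-arrow a (b + 1ℤ)))

    hub : Pt → List Pt
    hub (a , b) = face (shape a b) AB

    module _ {a b : ℤ} (t : SquareShape a b) where

      AB⇝A : Walk (face t AB) (hub (a , b))
      AB⇝A = subst (Walk (face t AB)) (faceAB-unique t (shape a b)) ε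

      DA⇝A : S (a , b) → Walk (face t DA) (hub (a , b))
      DA⇝A SA = around-A t SA ◅◅ AB⇝A

      BC⇝B : S (a + 1ℤ , b) → Walk (face t BC) (hub (a + 1ℤ , b))
      BC⇝B SB = across-BC t (shape (a + 1ℤ) b) (inj₁ SB) ◅◅ around-A (shape (a + 1ℤ) b) SB

      AB⇝B : S (a + 1ℤ , b) → Walk (face t AB) (hub (a + 1ℤ , b))
      AB⇝B SB = around-B t SB ◅◅ BC⇝B SB

      BC⇝C : S (a + 1ℤ , b + 1ℤ) → Walk (face t BC) (hub (a + 1ℤ , b + 1ℤ))
      BC⇝C SC = across-BC t right (inj₂ SC) ◅◅ reverse-walk (around-D right SC) ◅◅
                across-CD right (shape (a + 1ℤ) (b + 1ℤ)) (inj₂ SC)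
        where
        right : SquareShape (a + 1ℤ) b
        right = shape (a + 1ℤ) b

      CD⇝C : S (a + 1ℤ , b + 1ℤ) → Walk (face t CD) (hub (a + 1ℤ , b + 1ℤ))
      CD⇝C SC = reverse-walk (around-C t SC) ◅◅ BC⇝C SC

      CD⇝D : S (a , b + 1ℤ) → Walk (face t CD) (hub (a , b + 1ℤ))
      CD⇝D SD = across-CD t (shape a (b + 1ℤ)) (inj₂ SD)

      DA⇝D : S (a , b + 1ℤ) → Walk (face t DA) (hub (a , b + 1ℤ))
      DA⇝D SD = reverse-walk (around-D t SD) ◅◅ CD⇝D SD

    face⇝hub : ∀ {f} → Face h f → Any S f → Σ Pt λ q → S q × Walk f (hub q)
    face⇝hub (square A≡C B≡D) (here SA) = _ , SA , AB⇝A (flat A≡C B≡D)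
    face⇝hub (square A≡C B≡D) (there (here SB)) = _ , SB , AB⇝B (flat A≡C B≡D) SB
    face⇝hub (square A≡C B≡D) (there (there (here SC))) = _ , SC , BC⇝C (flat A≡C B≡D) SC
    face⇝hub (square A≡C B≡D) (there (there (there (here SD)))) = _ , SD , CD⇝D (flat A≡C B≡D) SD
    face⇝hub (triABC A≡C B≢D) (here SA) = _ , SA , AB⇝A (cutAC A≡C B≢D)
    face⇝hub (triABC A≡C B≢D) (there (here SB)) = _ , SB , AB⇝B (cutAC A≡C B≢D) SB
    face⇝hub (triABC A≡C B≢D) (there (there (here SC))) = _ , SC , BC⇝C (cutAC A≡C B≢D) SC
    face⇝hub (triACD A≡C B≢D) (here SA) = _ , SA , DA⇝A (cutAC A≡C B≢D) SA
    face⇝hub (triACD A≡C B≢D) (there (here SC)) = _ , SC , CD⇝C (cutAC A≡C B≢D) SC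
    face⇝hub (triACD A≡C B≢D) (there (there (here SD))) = _ , SD , CD⇝D (cutAC A≡C B≢D) SD
    face⇝hub (triABD B≡D A≢C) (here SA) = _ , SA , AB⇝A (cutBD B≡D A≢C)
    face⇝hub (triABD B≡D A≢C) (there (here SB)) = _ , SB , AB⇝B (cutBD B≡D A≢C) SB
    face⇝hub (triABD B≡D A≢C) (there (there (here SD))) = _ , SD , DA⇝D (cutBD B≡D A≢C) SD
    face⇝hub (triBCD B≡D A≢C) (here SB) = _ , SB , BC⇝B (cutBD B≡D A≢C) SB
    face⇝hub (triBCD B≡D A≢C) (there (here SC)) = _ , SC , BC⇝C (cutBD B≡D A≢C) SC
    face⇝hub (triBCD B≡D A≢C) (there (there (here SD))) = _ , SD , CD⇝D (cutBD B≡D A≢C) SD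

    Step⇒hub-walk : ∀ {q r} → Step q r → S q → S r → Walk (hub q) (hub r)
    Step⇒hub-walk {i , j} (horizontal (inj₁ refl)) _ Sr = AB⇝B (shape i j) Sr
    Step⇒hub-walk {_ , j} {i' , _} (horizontal (inj₂ refl)) Sq _ = reverse-walk (AB⇝B (shape i' j) Sq)
    Step⇒hub-walk {i , j} (vertical (inj₁ refl)) Sq Sr = reverse-walk (around-A (shape i j) Sq) ◅◅ DA⇝D (shape i j) Sr
    Step⇒hub-walk {i , _} {_ , j'} (vertical (inj₂ refl)) Sq Sr =
      reverse-walk (reverse-walk (around-A (shape i j') Sr) ◅◅ DA⇝D (shape i j') Sq)

    Path⇒hub-walk : ∀ {q r} → Path S q r → Walk (hub q) (hub r)
    Path⇒hub-walk ε = ε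
    Path⇒hub-walk ((q→r , Sq , Sr) ◅ rest) = Step⇒hub-walk q→r Sq Sr ◅◅ Path⇒hub-walk rest

    GenGraph-connected : ∀ c → (∀ q → S q → Path S q c) → Connected (GenVert h S) (GenEdge h S)
    GenGraph-connected c paths f g (Ff , S∩f) (Fg , S∩g) with face⇝hub Ff S∩f | face⇝hub Fg S∩g
    ... | q , Sq , f⇝q | r , Sr , g⇝r =
      f⇝q ◅◅ Path⇒hub-walk (paths q Sq) ◅◅ reverse-walk (Path⇒hub-walk (paths r Sr)) ◅◅ reverse-walk g⇝r

-- The regions F̊ and ∂F

margin-step : ∀ {d k0 x x'} → + suc d < k0 - x → x' ≤ x + 1ℤ → + d < k0 - x'
margin-step {d} {k0} {x} {x'} d+1<k0-x x'≤x+1 = begin-strict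
  + d                   ≡⟨⟩
  + suc d - 1ℤ          <⟨ ℤₚ.+-monoˡ-< (- 1ℤ) d+1<k0-x ⟩
  (k0 - x) - 1ℤ         ≡⟨ regroup k0 x ⟩
  k0 - (x + 1ℤ)         ≤⟨ ℤₚ.+-monoʳ-≤ k0 (ℤₚ.neg-mono-≤ x'≤x+1) ⟩
  k0 - x'               ∎
  where
  open ℤₚ.≤-Reasoning
  regroup : ∀ k0 x → (k0 - x) - 1ℤ ≡ k0 - (x + 1ℤ)
  regroup = solve-∀

module _ {k : Pt → ℤ} (steps : UnitSteps k) (c : Pt) (k0 : ℤ) where

  Fint-closer : ∀ q → Fint k c k0 q → q ≡ c ⊎ Σ Pt λ r → Step q r × dist r c ℕ.< dist q c × Fint k c k0 r
  Fint-closer q q∈F with closer-neighbour q c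
  ... | inj₁ q≡c = inj₁ q≡c
  ... | inj₂ (r , q→r , closer) =
    inj₂ (r , q→r , ℕₚ.≤-reflexive closer ,
          margin-step {k0 = k0} {k q} (subst (λ n → + n < k0 - k q) (sym closer) q∈F)
                      (OneApart⇒≤+1 (Step-OneApart steps q→r)))

  Fint-path : ∀ q → Fint k c k0 q → Path (Fint k c k0) q c
  Fint-path = path-to-centre c Fint-closer

Fcl-path : ∀ {k} → UnitSteps k → ∀ c k0 q → Fcl k c k0 q → Path (Fcl k c k0) q c
Fcl-path steps c k0 q (inj₁ q∈F) =
  Star.map (λ (s , Fq , Fr) → s , inj₁ Fq , inj₁ Fr) (Fint-path steps c k0 q q∈F)
Fcl-path steps c k0 q (inj₂ (inj₁ (_ , refl))) = ε
Fcl-path steps c k0 q (inj₂ q∈∂F@(inj₂ (_ , _ , r , q~r , r∈F))) =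
  (LatAdj⇒Step q~r , inj₂ q∈∂F , inj₁ r∈F) ◅ Fcl-path steps c k0 r (inj₁ r∈F)

proposition6p1 : (i0 j0 k0 : ℤ) (k : Pt → ℤ) →
    IsOdd (i0 + j0 + k0) →
    SteppedSurface k →
    k (i0 , j0) ≤ k0 →
    (∀ q → fund q ≤ k q) →
    (Bipartite k (G-Vert k (i0 , j0) k0) (G-Edge k (i0 , j0) k0) ×
     Connected (G-Vert k (i0 , j0) k0) (G-Edge k (i0 , j0) k0)) ×
    (Bipartite (kp k (i0 , j0) k0) (Gbar-Vert k (i0 , j0) k0) (Gbar-Edge k (i0 , j0) k0) ×
     Connected (Gbar-Vert k (i0 , j0) k0) (Gbar-Edge k (i0 , j0) k0))
proposition6p1 i0 j0 k0 k odd-p stepped _ _ =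
  (G.GenGraph-bipartite F̊ , G.Connectivity.GenGraph-connected F̊ c (Fint-path k-steps c k0)) ,
  (Ḡ.GenGraph-bipartite F̄ , Ḡ.Connectivity.GenGraph-connected F̄ c (Fcl-path k-steps c k0))
  where
  c : Pt
  c = (i0 , j0)
  F̊ F̄ : Pt → Set
  F̊ = Fint k c k0
  F̄ = Fcl k c k0
  k-steps : UnitSteps k
  k-steps = SteppedSurface⇒UnitSteps stepped
  kp-steps : UnitSteps (kp k c k0)
  kp-steps = UnitSteps-⊓ k-steps (proj-UnitSteps c k0) (Even-k-proj i0 j0 k0 odd-p (proj₁ stepped))
  module G = FaceGraph k-steps
  module Ḡ = FaceGraph kp-steps
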